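{- Let $H$ be a graph and let $G$ be a graph with $V(G)=M\cup\{u,v\}$ (with $u,v\notin M$, $u\neq v$), where $|M|=l$. Suppose $G[M]$ is $\mathcal{H}$-free, $G$ is $H$-free, and every graph in $EX(l,\mathcal{H})$ contains at least one member of $\mathcal{H}'$ as a subgraph. Then $e(G)\le ex(l,\mathcal{H})+2l$.
   Context: All graphs are simple; $G[M]$ is the subgraph induced by $M$ and $e(G)$ the number of edges. For a family $\mathcal{F}$ of graphs, a graph is $\mathcal{F}$-free if it contains no member of $\mathcal{F}$ as a subgraph; $ex(l,\mathcal{F})$ is the maximum number of edges of an $l$-vertex $\mathcal{F}$-free graph and $EX(l,\mathcal{F})$ the set of $l$-vertex $\mathcal{F}$-free graphs with $ex(l,\mathcal{F})$ edges. $\mathcal{H}$ is the family of graphs obtained from $H$ by deleting one color class of a proper $\chi(H)$-coloring of $H$; $\mathcal{H}'$ is the family of graphs obtained from $H$ by deleting two adjacent vertices of $H$. -}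

module Defs where

open import Data.Nat using (ℕ; zero; suc; _+_; _*_; _≤_; _<_; _<ᵇ_)
open import Data.Fin using (Fin; zero; suc; toℕ)
open import Data.Bool using (Bool; true; false; if_then_else_; _∧_)
open import Data.List using (List; map; allFin)
open import Data.Nat.ListAction using (sum)
open import Data.Product using (Σ; _×_; ∃; _,_)
open import Relation.Binary.PropositionalEquality using (_≡_; _≢_)
open import Relation.Nullary using (¬_)

record Graph (n : ℕ) : Set where
  field
    adj    : Fin n → Fin n → Bool
    sym    : ∀ i j → adj i j ≡ adj j i
    irrefl : ∀ i → adj i i ≡ false
open Graph public

e : ∀ {n} → Graph n → ℕ
e {n} G = sum (map (λ i → sum (map (λ j → if (toℕ i <ᵇ toℕ j) ∧ adj G i j then 1 else 0)
                                    (allFin n)))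
                   (allFin n))

-- Induced subgraph G[S] of H on the vertex subset S (given as a Bool predicate),
-- contained as a (not necessarily induced) subgraph of G: an injective map from
-- the vertices of S into V(G) preserving adjacency.
EmbedsSub : ∀ {m n} → Graph m → (Fin m → Bool) → Graph n → Set
EmbedsSub {m} {n} H S G =
  Σ ((i : Fin m) → S i ≡ true → Fin n) λ φ →
    (∀ i j (si : S i ≡ true) (sj : S j ≡ true) → φ i si ≡ φ j sj → i ≡ j)
    × (∀ i j (si : S i ≡ true) (sj : S j ≡ true) → adj H i j ≡ true →
         adj G (φ i si) (φ j sj) ≡ true)

Contains : ∀ {m n} → Graph n → Graph m → Set
Contains G H = EmbedsSub H (λ _ → true) G

ProperColoring : ∀ {m} → Graph m → (k : ℕ) → (Fin m → Fin k) → Set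
ProperColoring {m} H k c = ∀ i j → adj H i j ≡ true → c i ≢ c j

Colorable : ∀ {m} → Graph m → ℕ → Set
Colorable H k = Σ _ λ c → ProperColoring H k c

IsChromatic : ∀ {m} → Graph m → ℕ → Set
IsChromatic H k = Colorable H k × (∀ k' → k' < k → ¬ Colorable H k')

eqFin : ∀ {k} → Fin k → Fin k → Bool
eqFin zero zero = true
eqFin zero (suc _) = false
eqFin (suc _) zero = false
eqFin (suc a) (suc b) = eqFin a b

not : Bool → Bool
not true = false
not false = true

-- G contains a member of 𝓗: the graph obtained from H by deleting one colour
-- class of a proper χ(H)-colouring of H.
ContainsCalH : ∀ {m n} → Graph m → Graph n → Set
ContainsCalH {m} H G =
  Σ ℕ λ k → Σ (Fin m → Fin k) λ c → Σ (Fin k) λ a →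
    IsChromatic H k × ProperColoring H k c × EmbedsSub H (λ x → not (eqFin (c x) a)) G

CalHFree : ∀ {m n} → Graph m → Graph n → Set
CalHFree H G = ¬ ContainsCalH H G

-- G contains a member of 𝓗': H minus two adjacent vertices x, y.
ContainsCalH' : ∀ {m n} → Graph m → Graph n → Set
ContainsCalH' {m} H G =
  Σ (Fin m) λ x → Σ (Fin m) λ y →
    adj H x y ≡ true × EmbedsSub H (λ z → not (eqFin z x) ∧ not (eqFin z y)) G

HFree : ∀ {m n} → Graph m → Graph n → Set
HFree H G = ¬ Contains G H

IsExCalH : ∀ {m} → Graph m → ℕ → ℕ → Set
IsExCalH H l k =
  (Σ (Graph l) λ G → CalHFree H G × e G ≡ k)
  × (∀ (G : Graph l) → CalHFree H G → e G ≤ k)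

InEXCalH : ∀ {m l} → Graph m → ℕ → Graph l → Set
InEXCalH H k G = CalHFree H G × e G ≡ k

-- G[M] where V(G) = {u, v} ∪ M, with u = 0, v = 1, M = {2, …, l+1}.
restrictM : ∀ {l} → Graph (suc (suc l)) → Graph l
restrictM G = record
  { adj = λ i j → adj G (suc (suc i)) (suc (suc j))
  ; sym = λ i j → sym G (suc (suc i)) (suc (suc j))
  ; irrefl = λ i → irrefl G (suc (suc i)) }

-- Splitting off u and v, e(G) = [uv] + deg_M u + deg_M v + e(G[M]), where the last term is at
-- most ex(l, 𝓗) because G[M] is 𝓗-free.  If the sum exceeded ex(l, 𝓗) + 2l, then e(G[M]) would
-- equal ex(l, 𝓗) and u, v would be adjacent to each other and to all of M; then G[M] contains
-- H − x − y for some edge xy of H, and sending x ↦ u, y ↦ v extends this to a copy of H in G.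
module Submission where

open import Defs hiding (sym)
open import Data.Nat using (ℕ; zero; suc; _+_; _*_; _≤_; _<_; _<ᵇ_; s≤s; z≤n)
open import Data.Nat.Properties
  using (+-comm; +-assoc; +-suc; +-identityʳ; +-mono-≤; +-monoˡ-≤; +-monoʳ-≤; ≤-trans; ≤-reflexive; m≤n⇒m≤1+n; m≤n⇒m<n∨m≡n; module ≤-Reasoning)
open import Data.Fin using (Fin; zero; suc; toℕ)
open import Data.Fin.Properties using (suc-injective)
open import Data.Bool using (Bool; true; false; if_then_else_; _∧_)
open import Data.List using (map; tabulate; allFin)
open import Data.Nat.ListAction using (sum)
open import Data.Vec.Functional using (foldr)
open import Data.Product using (_×_; _,_)
open import Data.Sum using (_⊎_; inj₁; inj₂)
open import Data.Empty using (⊥-elim)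
open import Function using (_∘_; id)
open import Relation.Binary.PropositionalEquality using (_≡_; refl; sym; trans; cong; cong₂; module ≡-Reasoning)

∑ : ∀ {n} → (Fin n → ℕ) → ℕ
∑ = foldr _+_ 0

sum-map-tabulate : ∀ {A : Set} {n} (h : Fin n → A) {f : A → ℕ} {g : Fin n → ℕ} →
                   (∀ i → f (h i) ≡ g i) → sum (map f (tabulate h)) ≡ ∑ g
sum-map-tabulate {n = zero}  h eq = refl
sum-map-tabulate {n = suc n} h eq = cong₂ _+_ (eq zero) (sum-map-tabulate (h ∘ suc) (eq ∘ suc))

sum-map-allFin : ∀ {n} {f g : Fin n → ℕ} → (∀ i → f i ≡ g i) → sum (map f (allFin n)) ≡ ∑ g
sum-map-allFin {n} = sum-map-tabulate {n = n} id

iverson : Bool → ℕ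
iverson b = if b then 1 else 0

count : ∀ {n} → (Fin n → Bool) → ℕ
count f = ∑ (iverson ∘ f)

count≤n : ∀ {n} (f : Fin n → Bool) → count f ≤ n
count≤n {zero}  f = z≤n
count≤n {suc n} f with f zero
... | true  = s≤s (count≤n (f ∘ suc))
... | false = m≤n⇒m≤1+n (count≤n (f ∘ suc))

count<n⊎all : ∀ {n} (f : Fin n → Bool) → count f < n ⊎ (∀ j → f j ≡ true)
count<n⊎all {zero}  f = inj₂ λ ()
count<n⊎all {suc n} f with f zero in f0≡
... | false = inj₁ (s≤s (count≤n (f ∘ suc)))
... | true with count<n⊎all (f ∘ suc)
...   | inj₁ lt  = inj₁ (s≤s lt)
...   | inj₂ all = inj₂ λ { zero → f0≡ ; (suc j) → all j }

edgeCount : ∀ {n} → Graph n → ℕ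
edgeCount G = ∑ λ i → ∑ λ j → if (toℕ i <ᵇ toℕ j) ∧ adj G i j then 1 else 0

e≡edgeCount : ∀ {n} (G : Graph n) → e G ≡ edgeCount G
e≡edgeCount {n} G = sum-map-allFin {n} λ i → sum-map-allFin {n} λ j → refl

module Cone {l} (G : Graph (2 + l)) where

  uv-adjacent : Bool
  uv-adjacent = adj G zero (suc zero)

  neighbourhoodᵤ neighbourhoodᵥ : Fin l → Bool
  neighbourhoodᵤ j = adj G zero (suc (suc j))
  neighbourhoodᵥ j = adj G (suc zero) (suc (suc j))

  coneEdges : ℕ
  coneEdges = iverson uv-adjacent + count neighbourhoodᵤ + count neighbourhoodᵥ

  DominatingEdge : Set
  DominatingEdge = uv-adjacent ≡ true × (∀ j → neighbourhoodᵤ j ≡ true) × (∀ j → neighbourhoodᵥ j ≡ true)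

  e-split : e G ≡ coneEdges + e (restrictM G)
  e-split = begin
    e G                                      ≡⟨ e≡edgeCount G ⟩
    edgeCount G                              ≡⟨ cong (λ t → iverson uv-adjacent + count neighbourhoodᵤ + (count neighbourhoodᵥ + t))
                                                     (sym (e≡edgeCount (restrictM G))) ⟩
    iverson uv-adjacent + count neighbourhoodᵤ
      + (count neighbourhoodᵥ + e (restrictM G)) ≡⟨ sym (+-assoc (iverson uv-adjacent + count neighbourhoodᵤ) _ _) ⟩
    coneEdges + e (restrictM G)              ∎
    where open ≡-Reasoning

  coneEdges≤1+2l : coneEdges ≤ suc (l + l)
  coneEdges≤1+2l with uv-adjacent
  ... | true  = s≤s (+-mono-≤ (count≤n neighbourhoodᵤ) (count≤n neighbourhoodᵥ))
  ... | false = m≤n⇒m≤1+n (+-mono-≤ (count≤n neighbourhoodᵤ) (count≤n neighbourhoodᵥ))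

  coneEdges≤2l⊎dominatingEdge : coneEdges ≤ l + l ⊎ DominatingEdge
  coneEdges≤2l⊎dominatingEdge with uv-adjacent
  ... | false = inj₁ (+-mono-≤ (count≤n neighbourhoodᵤ) (count≤n neighbourhoodᵥ))
  ... | true with count<n⊎all neighbourhoodᵤ | count<n⊎all neighbourhoodᵥ
  ...   | inj₁ degᵤ<l | _           = inj₁ (+-mono-≤ degᵤ<l (count≤n neighbourhoodᵥ))
  ...   | inj₂ _      | inj₁ degᵥ<l = inj₁ (≤-trans (≤-reflexive (sym (+-suc _ _))) (+-mono-≤ (count≤n neighbourhoodᵤ) degᵥ<l))
  ...   | inj₂ allᵤ   | inj₂ allᵥ   = inj₂ (refl , allᵤ , allᵥ)

eqFin⇒≡ : ∀ {k} {a c : Fin k} → eqFin a c ≡ true → a ≡ c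
eqFin⇒≡ {a = zero}  {zero}  _ = refl
eqFin⇒≡ {a = suc a} {suc c} p = cong suc (eqFin⇒≡ p)

data Role {m} (x y i : Fin m) : Set where
  is-x  : i ≡ x → Role x y i
  is-y  : i ≡ y → Role x y i
  other : not (eqFin i x) ∧ not (eqFin i y) ≡ true → Role x y i

role : ∀ {m} (x y i : Fin m) → Role x y i
role x y i with eqFin i x in i≟x
... | true = is-x (eqFin⇒≡ i≟x)
... | false with eqFin i y in i≟y
...   | true  = is-y (eqFin⇒≡ i≟y)
...   | false = other (cong₂ (λ p q → not p ∧ not q) i≟x i≟y)

dominatingEdge+𝓗'⇒H : ∀ {m l} (H : Graph m) (G : Graph (2 + l)) → Cone.DominatingEdge G →
                      ContainsCalH' H (restrictM G) → Contains G H
dominatingEdge+𝓗'⇒H {l = l} H G (uv , u-dominates , v-dominates) (x , y , _ , ψ , ψ-injective , ψ-preserves) =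
  (λ i _ → φ (role x y i)) ,
  (λ i j _ _ → φ-injective (role x y i) (role x y j)) ,
  (λ i j _ _ → φ-preserves (role x y i) (role x y j))
  where
  φ : ∀ {i} → Role x y i → Fin (2 + l)
  φ (is-x _)  = zero
  φ (is-y _)  = suc zero
  φ (other p) = suc (suc (ψ _ p))

  φ-injective : ∀ {i j} (ri : Role x y i) (rj : Role x y j) → φ ri ≡ φ rj → i ≡ j
  φ-injective (is-x refl) (is-x refl) _ = refl
  φ-injective (is-y refl) (is-y refl) _ = refl
  φ-injective (other p)   (other q)   eq = ψ-injective _ _ p q (suc-injective (suc-injective eq))
  φ-injective (is-x _) (is-y _)  ()
  φ-injective (is-x _) (other _) ()
  φ-injective (is-y _) (is-x _)  ()
  φ-injective (is-y _) (other _) ()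
  φ-injective (other _) (is-x _) ()
  φ-injective (other _) (is-y _) ()

  no-loop : ∀ {z} {A : Set} → adj H z z ≡ true → A
  no-loop {z} h with trans (sym (irrefl H z)) h
  ... | ()

  φ-preserves : ∀ {i j} (ri : Role x y i) (rj : Role x y j) → adj H i j ≡ true → adj G (φ ri) (φ rj) ≡ true
  φ-preserves (is-x refl) (is-x refl) h = no-loop h
  φ-preserves (is-x _)    (is-y _)    _ = uv
  φ-preserves (is-x _)    (other _)   _ = u-dominates _
  φ-preserves (is-y _)    (is-x _)    _ = trans (Graph.sym G _ _) uv
  φ-preserves (is-y refl) (is-y refl) h = no-loop h
  φ-preserves (is-y _)    (other _)   _ = v-dominates _
  φ-preserves (other _)   (is-x _)    _ = trans (Graph.sym G _ _) (u-dominates _)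
  φ-preserves (other _)   (is-y _)    _ = trans (Graph.sym G _ _) (v-dominates _)
  φ-preserves (other p)   (other q)   h = ψ-preserves _ _ p q h

lemma5 : ∀ {m} (H : Graph m) (l : ℕ) (G : Graph (2 + l)) (exv : ℕ) →
         IsExCalH H l exv →
         CalHFree H (restrictM G) →
         HFree H G →
         (∀ (F : Graph l) → InEXCalH H exv F → ContainsCalH' H F) →
         e G ≤ exv + 2 * l
lemma5 H l G exv (_ , ex-maximal) G[M]-free H-free extremal⇒𝓗' = begin
  e G                          ≡⟨ e-split ⟩
  coneEdges + e (restrictM G)  ≤⟨ e≤2l+ex (m≤n⇒m<n∨m≡n (ex-maximal (restrictM G) G[M]-free)) ⟩
  l + l + exv                  ≡⟨ +-comm (l + l) exv ⟩
  exv + (l + l)                ≡⟨ cong (λ k → exv + (l + k)) (sym (+-identityʳ l)) ⟩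
  exv + 2 * l                  ∎
  where
  open Cone G
  open ≤-Reasoning

  e≤2l+ex : e (restrictM G) < exv ⊎ e (restrictM G) ≡ exv → coneEdges + e (restrictM G) ≤ l + l + exv
  e≤2l+ex (inj₁ e<ex) = begin
    coneEdges + e (restrictM G)    ≤⟨ +-monoˡ-≤ (e (restrictM G)) coneEdges≤1+2l ⟩
    suc (l + l) + e (restrictM G)  ≡⟨ sym (+-suc (l + l) (e (restrictM G))) ⟩
    l + l + suc (e (restrictM G))  ≤⟨ +-monoʳ-≤ (l + l) e<ex ⟩
    l + l + exv                    ∎
  e≤2l+ex (inj₂ e≡ex) with coneEdges≤2l⊎dominatingEdge
  ... | inj₁ cone≤2l = +-mono-≤ cone≤2l (≤-reflexive e≡ex)
  ... | inj₂ dominating =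
    ⊥-elim (H-free (dominatingEdge+𝓗'⇒H H G dominating (extremal⇒𝓗' (restrictM G) (G[M]-free , e≡ex))))
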